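{- Let $n\ge1$, let $a=(a_1,a_2,a_3,a_4)$ be a vertex of $\Phi(\mathbb H(\mathbb Z_{2^n}))$, and let $B=\{b\in\mathbb H(\mathbb Z_{2^n}) : ab=0\}$. Then: (i) if $n=1$, $\deg(a)=2^{4n}-|B|-1$ when $a^2=0$, and $\deg(a)=2^{4n}-|B|-2$ when $a^2\neq0$; (ii) if $n>1$, $\deg(a)=2^{4n}-|B|-2$ when $a^2=0$, and $\deg(a)=2^{4n}-|B|-3$ when $a^2\neq0$. Moreover, $|B|=\prod_{i=1}^4\gcd(d_i,2^n)$, where $\operatorname{diag}(d_1,d_2,d_3,d_4)$ is the Smith normal form of the coefficient matrix $$\mathcal A=\begin{pmatrix}a_1&-a_2&-a_3&-a_4\\ a_2&a_1&-a_4&a_3\\ a_3&a_4&a_1&-a_2\\ a_4&-a_3&a_2&a_1\end{pmatrix}$$ of the linear system $ab=0$ in the unknowns $b=(b_1,b_2,b_3,b_4)$.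
   Context: $\mathbb H(\mathbb Z_{2^n})$ is the ring of Hamilton quaternions over $\mathbb Z_{2^n}$. Its elements are $a_1+a_2i+a_3j+a_4k$ with $a_i\in\mathbb Z_{2^n}$, written $(a_1,a_2,a_3,a_4)$. Addition is coordinatewise, and multiplication is determined by distributivity, scalars commuting with $i,j,k$, and $i^2=j^2=k^2=-1$, $ij=-ji=k$, $jk=-kj=i$, $ki=-ik=j$. Explicitly, $(a_1,a_2,a_3,a_4)(b_1,b_2,b_3,b_4)=(a_1b_1-a_2b_2-a_3b_3-a_4b_4,\ a_2b_1+a_1b_2-a_4b_3+a_3b_4,\ a_3b_1+a_4b_2+a_1b_3-a_2b_4,\ a_4b_1-a_3b_2+a_2b_3+a_1b_4)$ modulo $2^n$, so $ab=0$ is the linear congruence system $\mathcal A\,b^{T}\equiv0 \pmod{2^n}$. The graph $\Phi(\mathbb H(\mathbb Z_{2^n}))$ has vertex set $\mathbb H(\mathbb Z_{2^n})\setminus\{(0,0,0,0),(1,0,0,0),(2^n-1,0,0,0)\}$. For this ring the paper defines adjacency of distinct vertices $a,b$ by $ab\neq0$, so $\deg(a)$ is the number of vertices $b\neq a$ with $ab\neq0$. The Smith normal form is taken for the integer matrix obtained from integer representatives of the $a_i$. It is the diagonal matrix $\operatorname{diag}(d_1,\dots,d_4)$, with $d_1\mid d_2\mid d_3\mid d_4$, equivalent to $\mathcal A$ under invertible row and column operations, and some $d_i$ may be $0$, with $\gcd(0,2^n)=2^n$. -}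

module Defs where

open import Data.Nat as ℕ using (ℕ; suc; NonZero)
open import Data.Nat.Properties using (m^n≢0)
open import Data.Nat.DivMod using (_mod_)
open import Data.Integer as ℤ using (ℤ; +_; _%ℕ_)
open import Data.Integer.Divisibility using (_∣_)
open import Data.Integer.GCD using (gcd)
open import Data.Fin as Fin using (Fin; toℕ; fromℕ)
open import Data.Fin.Properties using () renaming (_≟_ to _≟F_)
open import Data.Product using (_×_; _,_; Σ)
open import Data.Product.Properties using (≡-dec)
open import Data.List using (List; allFin; cartesianProduct; filter; length)
open import Relation.Nullary using (¬_; Dec; yes; no)
open import Relation.Nullary.Decidable using (_×-dec_; ¬?)
open import Relation.Binary.PropositionalEquality using (_≡_; _≢_)

modulus : ℕ → ℕ
modulus n = 2 ℕ.^ n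

modulus-nonZero : ∀ n → NonZero (modulus n)
modulus-nonZero n = m^n≢0 2 n

Zmod : ℕ → Set
Zmod n = Fin (modulus n)

rep : ∀ n → Zmod n → ℤ
rep n x = + toℕ x

red : ∀ n → ℤ → Zmod n
red n z = _mod_ (_%ℕ_ z (modulus n) {{modulus-nonZero n}}) (modulus n) {{modulus-nonZero n}}

-- Hamilton quaternions over ℤ_{2^n}: (a₁ , a₂ , a₃ , a₄) ↔ a₁ + a₂ i + a₃ j + a₄ k

H : ℕ → Set
H n = Zmod n × Zmod n × Zmod n × Zmod n

decH : ∀ n (a b : H n) → Dec (a ≡ b)
decH n = ≡-dec _≟F_ (≡-dec _≟F_ (≡-dec _≟F_ _≟F_))

mulH : ∀ n → H n → H n → H n
mulH n (a₁ , a₂ , a₃ , a₄) (b₁ , b₂ , b₃ , b₄) =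
    red n (x₁ ℤ.* y₁ ℤ.- x₂ ℤ.* y₂ ℤ.- x₃ ℤ.* y₃ ℤ.- x₄ ℤ.* y₄)
  , red n (x₂ ℤ.* y₁ ℤ.+ x₁ ℤ.* y₂ ℤ.- x₄ ℤ.* y₃ ℤ.+ x₃ ℤ.* y₄)
  , red n (x₃ ℤ.* y₁ ℤ.+ x₄ ℤ.* y₂ ℤ.+ x₁ ℤ.* y₃ ℤ.- x₂ ℤ.* y₄)
  , red n (x₄ ℤ.* y₁ ℤ.- x₃ ℤ.* y₂ ℤ.+ x₂ ℤ.* y₃ ℤ.+ x₁ ℤ.* y₄)
  where
  x₁ = rep n a₁ ; x₂ = rep n a₂ ; x₃ = rep n a₃ ; x₄ = rep n a₄
  y₁ = rep n b₁ ; y₂ = rep n b₂ ; y₃ = rep n b₃ ; y₄ = rep n b₄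

zeroH : ∀ n → H n
zeroH n = red n (+ 0) , red n (+ 0) , red n (+ 0) , red n (+ 0)

oneH : ∀ n → H n
oneH n = red n (+ 1) , red n (+ 0) , red n (+ 0) , red n (+ 0)

minusOneH : ∀ n → H n
minusOneH n = red n (ℤ.- (+ 1)) , red n (+ 0) , red n (+ 0) , red n (+ 0)

allH : ∀ n → List (H n)
allH n = cartesianProduct (allFin m) (cartesianProduct (allFin m) (cartesianProduct (allFin m) (allFin m)))
  where m = modulus n

countH : ∀ n {P : H n → Set} → ((x : H n) → Dec (P x)) → ℕ
countH n P? = length (filter P? (allH n))

IsVertex : ∀ n → H n → Set
IsVertex n a = (a ≢ zeroH n) × (a ≢ oneH n) × (a ≢ minusOneH n)

isVertex? : ∀ n (a : H n) → Dec (IsVertex n a)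
isVertex? n a = ¬? (decH n a (zeroH n)) ×-dec (¬? (decH n a (oneH n)) ×-dec ¬? (decH n a (minusOneH n)))

deg : ∀ n → H n → ℕ
deg n a = countH n (λ b → isVertex? n b ×-dec (¬? (decH n b a) ×-dec ¬? (decH n (mulH n a b) (zeroH n))))

annCard : ∀ n → H n → ℕ
annCard n a = countH n (λ b → decH n (mulH n a b) (zeroH n))

Mat : Set
Mat = Fin 4 → Fin 4 → ℤ

sum4 : (Fin 4 → ℤ) → ℤ
sum4 f = f Fin.zero ℤ.+ f (Fin.suc Fin.zero) ℤ.+ f (Fin.suc (Fin.suc Fin.zero))
         ℤ.+ f (Fin.suc (Fin.suc (Fin.suc Fin.zero)))

_⊗_ : Mat → Mat → Mat
(M ⊗ N) i j = sum4 (λ k → M i k ℤ.* N k j)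

_≈M_ : Mat → Mat → Set
M ≈M N = ∀ i j → M i j ≡ N i j

idM : Mat
idM i j with i ≟F j
... | yes _ = + 1
... | no  _ = + 0

diagM : (Fin 4 → ℤ) → Mat
diagM d i j with i ≟F j
... | yes _ = d i
... | no  _ = + 0

Invertible : Mat → Set
Invertible U = Σ Mat (λ U' → ((U ⊗ U') ≈M idM) × ((U' ⊗ U) ≈M idM))

f0 f1 f2 f3 : Fin 4
f0 = Fin.zero
f1 = Fin.suc Fin.zero
f2 = Fin.suc (Fin.suc Fin.zero)
f3 = Fin.suc (Fin.suc (Fin.suc Fin.zero))

IsSmithNormalFormOf : (Fin 4 → ℤ) → Mat → Set
IsSmithNormalFormOf d M =
  (d f0 ∣ d f1) × (d f1 ∣ d f2) × (d f2 ∣ d f3) ×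
  Σ Mat (λ U → Σ Mat (λ V → Invertible U × Invertible V × ((U ⊗ M) ⊗ V) ≈M diagM d))

coeffMatrix : ∀ n → H n → Mat
coeffMatrix n (a₁ , a₂ , a₃ , a₄) = row
  where
  x₁ = rep n a₁ ; x₂ = rep n a₂ ; x₃ = rep n a₃ ; x₄ = rep n a₄
  entry : Fin 4 → Fin 4 → ℤ
  entry Fin.zero Fin.zero = x₁
  entry Fin.zero (Fin.suc Fin.zero) = ℤ.- x₂
  entry Fin.zero (Fin.suc (Fin.suc Fin.zero)) = ℤ.- x₃
  entry Fin.zero (Fin.suc (Fin.suc (Fin.suc Fin.zero))) = ℤ.- x₄
  entry (Fin.suc Fin.zero) Fin.zero = x₂
  entry (Fin.suc Fin.zero) (Fin.suc Fin.zero) = x₁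
  entry (Fin.suc Fin.zero) (Fin.suc (Fin.suc Fin.zero)) = ℤ.- x₄
  entry (Fin.suc Fin.zero) (Fin.suc (Fin.suc (Fin.suc Fin.zero))) = x₃
  entry (Fin.suc (Fin.suc Fin.zero)) Fin.zero = x₃
  entry (Fin.suc (Fin.suc Fin.zero)) (Fin.suc Fin.zero) = x₄
  entry (Fin.suc (Fin.suc Fin.zero)) (Fin.suc (Fin.suc Fin.zero)) = x₁
  entry (Fin.suc (Fin.suc Fin.zero)) (Fin.suc (Fin.suc (Fin.suc Fin.zero))) = ℤ.- x₂
  entry (Fin.suc (Fin.suc (Fin.suc Fin.zero))) Fin.zero = x₄
  entry (Fin.suc (Fin.suc (Fin.suc Fin.zero))) (Fin.suc Fin.zero) = ℤ.- x₃
  entry (Fin.suc (Fin.suc (Fin.suc Fin.zero))) (Fin.suc (Fin.suc Fin.zero)) = x₂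
  entry (Fin.suc (Fin.suc (Fin.suc Fin.zero))) (Fin.suc (Fin.suc (Fin.suc Fin.zero))) = x₁
  row = entry

-- ∏_{i=1}^4 gcd(dᵢ, 2^n)   (with gcd(0, 2^n) = 2^n)
gcdProduct : ℕ → (Fin 4 → ℤ) → ℤ
gcdProduct n d = gcd (d f0) m ℤ.* gcd (d f1) m ℤ.* gcd (d f2) m ℤ.* gcd (d f3) m
  where m = + modulus n

-- The product ab is the reduction of the integer vector 𝒜·b, so b ↦ ab is the action of the integer
-- matrix 𝒜 on ℤ_{2ⁿ}⁴, and B is the set of solutions of 𝒜b ≡ 0 (mod 2ⁿ).
--
-- Degree: the elements b with ab ≠ 0 are the neighbours of a together with the non-adjacent b with
-- ab ≠ 0, namely 1 and -1 (never annihilated, since a·(±1) = ±a ≠ 0; equal exactly when n = 1) and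
-- a itself when a² ≠ 0. Counting the complement of B gives the four formulas.
--
-- |B|: if U𝒜V = diag(d) with U, V unimodular, then z ↦ Vz permutes ℤ_{2ⁿ}⁴ and 𝒜Vz ≡ 0 iff
-- diag(d)z ≡ 0, which splits into the four congruences dᵢzᵢ ≡ 0. Writing g = gcd(c, m), m = gm′ and
-- c = gc′ with c′ coprime to m′, the congruence ct ≡ 0 (mod m) means m′ ∣ t, which has g solutions
-- t < m.

module Submission where

open import Defs
open import Data.Nat using (ℕ)
open import Data.Product using (_×_; _,_; proj₁; proj₂)
open import Function using (id; _∘_; _⇔_; mk⇔; Equivalence)
import Function.Properties.Equivalence as ⇔
open import Relation.Binary.PropositionalEquality

module Counting where

  open import Level using (Level)
  open import Data.Nat as ℕ using (zero; suc; _+_; _*_; NonZero; _/_)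
  import Data.Nat.Properties as ℕ
  open import Data.Nat.Divisibility using (_∣_; _∣?_; divides; n∣m*n; *-cancelˡ-∣; *-pres-∣)
  open import Data.Nat.DivMod using (m*[n/m]≡n)
  open import Data.Nat.GCD using (gcd; gcd[m,n]∣m; gcd[m,n]∣n; gcd[m,n]≢0; n/gcd[m,n]≢0)
  open import Data.Nat.Coprimality using (coprime-/gcd; coprime-divisor)
  import Data.Nat.Coprimality as Coprime
  open import Data.Sum using (inj₂)
  open import Data.Fin using (toℕ)
  open import Data.List
    using (List; []; _∷_; _++_; length; filter; map; cartesianProduct; upTo; applyUpTo; tabulate; allFin)
  open import Data.List.Properties
    using (length-++; length-map; length-upTo; filter-++; filter-none; filter-≐; map-tabulate)
  import Data.List.Relation.Unary.All as All
  open import Data.List.Membership.Propositional using (_∈_)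
  open import Data.List.Membership.Propositional.Properties
    using (∈-filter⁺; ∈-filter⁻; ∈-map⁺; ∈-map⁻; ∈-upTo⁺; ∈-upTo⁻)
  open import Data.List.Membership.Propositional.Properties.WithK using (unique∧set⇒bag)
  open import Data.List.Relation.Binary.BagAndSetEquality using (_∼[_]_; set; ∼bag⇒↭)
  open import Data.List.Relation.Binary.Permutation.Propositional using (_↭_)
  open import Data.List.Relation.Binary.Permutation.Propositional.Properties using (↭-length; filter-↭)
  open import Data.List.Relation.Unary.Unique.Propositional using (Unique)
  import Data.List.Relation.Unary.Unique.Propositional.Properties as Unique
  open import Relation.Nullary using (yes; no)
  open import Relation.Nullary.Decidable using (_×-dec_)
  open import Relation.Unary using (Pred; Decidable; _≐_)
  open import Relation.Unary.Properties using (∁?; _∩?_)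

  private variable
    a p q : Level
    A B : Set a

  count : {P : Pred A p} → Decidable P → List A → ℕ
  count P? xs = length (filter P? xs)

  module _ {P : Pred A p} (P? : Decidable P) where

    count+count∁≡length : ∀ xs → count P? xs + count (∁? P?) xs ≡ length xs
    count+count∁≡length [] = refl
    count+count∁≡length (x ∷ xs) with P? x
    ... | yes _ = cong suc (count+count∁≡length xs)
    ... | no  _ = trans (ℕ.+-suc _ _) (cong suc (count+count∁≡length xs))

    count≡count∩+count∩∁ : {Q : Pred A q} (Q? : Decidable Q) → ∀ xs →
      count P? xs ≡ count (P? ∩? Q?) xs + count (P? ∩? ∁? Q?) xs
    count≡count∩+count∩∁ Q? [] = refl
    count≡count∩+count∩∁ Q? (x ∷ xs) with P? x | Q? x
    ... | yes _ | yes _ = cong suc (count≡count∩+count∩∁ Q? xs)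
    ... | yes _ | no  _ = trans (cong suc (count≡count∩+count∩∁ Q? xs)) (sym (ℕ.+-suc _ _))
    ... | no  _ | _     = count≡count∩+count∩∁ Q? xs

    count-≐ : {Q : Pred A q} (Q? : Decidable Q) → P ≐ Q → ∀ xs → count P? xs ≡ count Q? xs
    count-≐ Q? P≐Q xs = cong length (filter-≐ P? Q? P≐Q xs)

    count-++ : ∀ xs ys → count P? (xs ++ ys) ≡ count P? xs + count P? ys
    count-++ xs ys = trans (cong length (filter-++ P? xs ys)) (length-++ (filter P? xs))

    count-↭ : ∀ {xs ys} → xs ↭ ys → count P? xs ≡ count P? ys
    count-↭ = ↭-length ∘ filter-↭ P?

  count-map : {P : Pred B p} (P? : Decidable P) (f : A → B) → ∀ xs → count P? (map f xs) ≡ count (P? ∘ f) xs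
  count-map P? f [] = refl
  count-map P? f (x ∷ xs) with P? (f x)
  ... | yes _ = cong suc (count-map P? f xs)
  ... | no  _ = count-map P? f xs

  unique∧set⇒↭ : {xs ys : List A} → Unique xs → Unique ys → xs ∼[ set ] ys → xs ↭ ys
  unique∧set⇒↭ xs! ys! xs≈ys = ∼bag⇒↭ (unique∧set⇒bag xs! ys! xs≈ys)

  count≡length : {P : Pred A p} (P? : Decidable P) {xs ys : List A} → Unique xs → Unique ys →
    (∀ {x} → (x ∈ xs × P x) ⇔ x ∈ ys) → count P? xs ≡ length ys
  count≡length P? xs! ys! eq = ↭-length (unique∧set⇒↭ (Unique.filter⁺ P? xs!) ys!
    (mk⇔ (Equivalence.to eq ∘ ∈-filter⁻ P?)
         (λ x∈ys → let (x∈xs , px) = Equivalence.from eq x∈ys in ∈-filter⁺ P? x∈xs px)))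

  count-cartesianProduct : {P : Pred A p} {Q : Pred B q} (P? : Decidable P) (Q? : Decidable Q) → ∀ xs ys →
    count (λ xy → P? (proj₁ xy) ×-dec Q? (proj₂ xy)) (cartesianProduct xs ys) ≡ count P? xs * count Q? ys
  count-cartesianProduct P? Q? [] ys = refl
  count-cartesianProduct {P = P} {Q} P? Q? (x ∷ xs) ys = begin
      count P×Q? (map (x ,_) ys ++ cartesianProduct xs ys)
    ≡⟨ count-++ P×Q? (map (x ,_) ys) _ ⟩
      count P×Q? (map (x ,_) ys) + count P×Q? (cartesianProduct xs ys)
    ≡⟨ cong₂ _+_ (count-map P×Q? (x ,_) ys) (count-cartesianProduct P? Q? xs ys) ⟩
      count (λ y → P? x ×-dec Q? y) ys + count P? xs * count Q? ys
    ≡⟨ head-row ⟩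
      count P? (x ∷ xs) * count Q? ys ∎
    where
    open ≡-Reasoning
    P×Q? : Decidable (λ xy → P (proj₁ xy) × Q (proj₂ xy))
    P×Q? xy = P? (proj₁ xy) ×-dec Q? (proj₂ xy)
    head-row : count (λ y → P? x ×-dec Q? y) ys + count P? xs * count Q? ys ≡ count P? (x ∷ xs) * count Q? ys
    head-row with P? x
    ... | yes px = cong (_+ _) (count-≐ _ Q? (proj₂ , (px ,_)) ys)
    ... | no ¬px = cong (λ zs → length zs + count P? xs * count Q? ys)
                        (filter-none (λ y → no ¬px ×-dec Q? y) {ys} (All.tabulate λ _ → ¬px ∘ proj₁))

  length-cartesianProduct : (xs : List A) (ys : List B) → length (cartesianProduct xs ys) ≡ length xs * length ys
  length-cartesianProduct [] ys = refl
  length-cartesianProduct (x ∷ xs) ys = begin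
      length (map (x ,_) ys ++ cartesianProduct xs ys)
    ≡⟨ length-++ (map (x ,_) ys) ⟩
      length (map (x ,_) ys) + length (cartesianProduct xs ys)
    ≡⟨ cong₂ _+_ (length-map (x ,_) ys) (length-cartesianProduct xs ys) ⟩
      length ys + length xs * length ys ∎
    where open ≡-Reasoning

  module Enumeration {xs : List A} (xs! : Unique xs) (∈xs : ∀ x → x ∈ xs) where

    count≡length-of : {P : Pred A p} (P? : Decidable P) {ys : List A} → Unique ys →
      (∀ {x} → P x ⇔ x ∈ ys) → count P? xs ≡ length ys
    count≡length-of P? ys! eq =
      count≡length P? xs! ys! (mk⇔ (Equivalence.to eq ∘ proj₂) (λ x∈ys → ∈xs _ , Equivalence.from eq x∈ys))

    count-∘-inverse : {P : Pred A p} (P? : Decidable P) (f g : A → A) →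
      (∀ x → g (f x) ≡ x) → (∀ x → f (g x) ≡ x) → count P? xs ≡ count (P? ∘ f) xs
    count-∘-inverse P? f g gf fg = begin
        count P? xs
      ≡⟨ count-↭ P?
           (unique∧set⇒↭ xs! (Unique.map⁺ f-injective xs!) (mk⇔ (λ _ → ∈f[xs] _) (λ _ → ∈xs _))) ⟩
        count P? (map f xs)
      ≡⟨ count-map P? f xs ⟩
        count (P? ∘ f) xs ∎
      where
      open ≡-Reasoning
      f-injective : ∀ {x y} → f x ≡ f y → x ≡ y
      f-injective {x} {y} fx≡fy = trans (sym (gf x)) (trans (cong g fx≡fy) (gf y))
      ∈f[xs] : ∀ x → x ∈ map f xs
      ∈f[xs] x = subst (_∈ map f xs) (fg x) (∈-map⁺ f (∈xs (g x)))

  tabulate-∘toℕ : ∀ {a} {A : Set a} (f : ℕ → A) n → tabulate (f ∘ toℕ {n}) ≡ applyUpTo f n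
  tabulate-∘toℕ f zero = refl
  tabulate-∘toℕ f (suc n) = cong (f 0 ∷_) (tabulate-∘toℕ (f ∘ suc) n)

  map-toℕ-allFin : ∀ n → map toℕ (allFin n) ≡ upTo n
  map-toℕ-allFin n = trans (map-tabulate id toℕ) (tabulate-∘toℕ id n)

  count-multiples : ∀ k g .{{_ : NonZero k}} → count (k ∣?_) (upTo (g * k)) ≡ g
  count-multiples k g = begin
      count (k ∣?_) (upTo (g * k))
    ≡⟨ count≡length (k ∣?_) (Unique.upTo⁺ (g * k)) (Unique.map⁺ (ℕ.*-cancelʳ-≡ _ _ k) (Unique.upTo⁺ g))
         (mk⇔ to from) ⟩
      length (map (_* k) (upTo g))
    ≡⟨ trans (length-map (_* k) (upTo g)) (length-upTo g) ⟩
      g ∎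
    where
    open ≡-Reasoning
    to : ∀ {t} → (t ∈ upTo (g * k) × k ∣ t) → t ∈ map (_* k) (upTo g)
    to (t∈ , divides q refl) = ∈-map⁺ (_* k) (∈-upTo⁺ (ℕ.*-cancelʳ-< _ q g (∈-upTo⁻ t∈)))
    from : ∀ {t} → t ∈ map (_* k) (upTo g) → (t ∈ upTo (g * k) × k ∣ t)
    from t∈ with j , j∈ , refl ← ∈-map⁻ (_* k) t∈ = ∈-upTo⁺ (ℕ.*-monoˡ-< k (∈-upTo⁻ j∈)) , n∣m*n j

  count-∣-*≡gcd : ∀ c m .{{_ : NonZero m}} → count (λ t → m ∣? c * t) (upTo m) ≡ gcd c m
  count-∣-*≡gcd c m = begin
      count (λ t → m ∣? c * t) (upTo m)
    ≡⟨ count-≐ _ (m′ ∣?_) (to , from) (upTo m) ⟩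
      count (m′ ∣?_) (upTo m)
    ≡⟨ cong (count (m′ ∣?_) ∘ upTo) (sym g*m′≡m) ⟩
      count (m′ ∣?_) (upTo (g * m′))
    ≡⟨ count-multiples m′ g ⟩
      g ∎
    where
    open ≡-Reasoning
    g : ℕ
    g = gcd c m
    instance
      g≢0 : NonZero g
      g≢0 = ℕ.≢-nonZero (gcd[m,n]≢0 c m (inj₂ (ℕ.≢-nonZero⁻¹ m)))
    m′ c′ : ℕ
    m′ = m / g
    c′ = c / g
    instance
      m′≢0 : NonZero m′
      m′≢0 = ℕ.≢-nonZero (n/gcd[m,n]≢0 c m)
    g*m′≡m : g * m′ ≡ m
    g*m′≡m = m*[n/m]≡n (gcd[m,n]∣n c m)
    to : ∀ {t} → m ∣ c * t → m′ ∣ t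
    to {t} m∣ct = coprime-divisor (Coprime.sym (coprime-/gcd c m))
                    (*-cancelˡ-∣ g (subst₂ _∣_ (sym g*m′≡m) c*t≡g*[c′*t] m∣ct))
      where
      c*t≡g*[c′*t] : c * t ≡ g * (c′ * t)
      c*t≡g*[c′*t] = trans (cong (_* t) (sym (m*[n/m]≡n (gcd[m,n]∣m c m)))) (ℕ.*-assoc g c′ t)
    from : ∀ {t} → m′ ∣ t → m ∣ c * t
    from m′∣t = subst (_∣ _) g*m′≡m (*-pres-∣ (gcd[m,n]∣m c m) m′∣t)

open Counting

module Congruence where

  open import Data.Nat as ℕ using (NonZero)
  import Data.Nat.Properties as ℕ
  import Data.Nat.Divisibility as ℕ
  open import Data.Nat.DivMod using (m<n⇒m%n≡m)
  open import Data.Integer as ℤ using (ℤ; +_; _+_; _-_; _*_; -_; ∣_∣; _%ℕ_; _/ℕ_)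
  import Data.Integer.Properties as ℤ
  open import Data.Integer.DivMod using (a≡a%ℕn+[a/ℕn]*n; n%ℕd<d)
  open import Data.Integer.Divisibility.Signed
    using (_∣_; divides; ∣m∣n⇒∣m+n; ∣n⇒∣m*n; ∣m⇒∣m*n; ∣m⇒∣-m; ∣⇒∣ᵤ; ∣ᵤ⇒∣)
  open import Data.Integer.Tactic.RingSolver using (solve-∀)
  open import Data.Fin using (toℕ)
  open import Data.Fin.Properties using (toℕ-fromℕ<; toℕ-injective; toℕ<n)

  infix 4 _≡_mod_

  -- A record rather than a synonym for k ∣ u - w, so that u and w can be inferred from a proof.
  record _≡_mod_ (u w k : ℤ) : Set where
    constructor mk≡mod
    field divides-difference : k ∣ u - w

  module _ {k : ℤ} where

    ≡-mod-refl : ∀ u → u ≡ u mod k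
    ≡-mod-refl u = mk≡mod (subst (k ∣_) (sym (ℤ.+-inverseʳ u)) (∣ᵤ⇒∣ (∣ k ∣ ℕ.∣0)))

    ≡⇒≡-mod : ∀ {u w} → u ≡ w → u ≡ w mod k
    ≡⇒≡-mod refl = ≡-mod-refl _

    ≡-mod-sym : ∀ {u w} → u ≡ w mod k → w ≡ u mod k
    ≡-mod-sym {u} {w} (mk≡mod k∣u-w) = mk≡mod (subst (k ∣_) (identity u w) (∣m⇒∣-m k∣u-w))
      where
      identity : ∀ u w → - (u - w) ≡ w - u
      identity = solve-∀

    ≡-mod-trans : ∀ {u v w} → u ≡ v mod k → v ≡ w mod k → u ≡ w mod k
    ≡-mod-trans {u} {v} {w} (mk≡mod k∣u-v) (mk≡mod k∣v-w) =
      mk≡mod (subst (k ∣_) (identity u v w) (∣m∣n⇒∣m+n k∣u-v k∣v-w))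
      where
      identity : ∀ u v w → (u - v) + (v - w) ≡ u - w
      identity = solve-∀

    ≡-mod-+ : ∀ {u u′ w w′} → u ≡ u′ mod k → w ≡ w′ mod k → u + w ≡ u′ + w′ mod k
    ≡-mod-+ {u} {u′} {w} {w′} (mk≡mod k∣u-u′) (mk≡mod k∣w-w′) =
      mk≡mod (subst (k ∣_) (identity u u′ w w′) (∣m∣n⇒∣m+n k∣u-u′ k∣w-w′))
      where
      identity : ∀ u u′ w w′ → (u - u′) + (w - w′) ≡ (u + w) - (u′ + w′)
      identity = solve-∀

    ≡-mod-* : ∀ {u u′ w w′} → u ≡ u′ mod k → w ≡ w′ mod k → u * w ≡ u′ * w′ mod k
    ≡-mod-* {u} {u′} {w} {w′} (mk≡mod k∣u-u′) (mk≡mod k∣w-w′) =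
      mk≡mod (subst (k ∣_) (identity u u′ w w′) (∣m∣n⇒∣m+n (∣m⇒∣m*n w k∣u-u′) (∣n⇒∣m*n u′ k∣w-w′)))
      where
      identity : ∀ u u′ w w′ → (u - u′) * w + u′ * (w - w′) ≡ u * w - u′ * w′
      identity = solve-∀

    ≡0-mod⇔∣ : ∀ {u} → u ≡ + 0 mod k ⇔ k ∣ u
    ≡0-mod⇔∣ {u} = mk⇔ (λ (mk≡mod k∣u-0) → subst (k ∣_) (ℤ.+-identityʳ u) k∣u-0)
                       (λ k∣u → mk≡mod (subst (k ∣_) (sym (ℤ.+-identityʳ u)) k∣u))

  module _ (m : ℕ) .{{_ : NonZero m}} where

    %ℕ≡-mod : ∀ u → + (u %ℕ m) ≡ u mod + m
    %ℕ≡-mod u = mk≡mod (divides (- (u /ℕ m))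
      (trans (cong (λ v → + (u %ℕ m) - v) (a≡a%ℕn+[a/ℕn]*n u m)) (identity (+ (u %ℕ m)) (u /ℕ m) (+ m))))
      where
      identity : ∀ r q m → r - (r + q * m) ≡ - q * m
      identity = solve-∀

    <∧≡-mod⇒≡ : ∀ {r s} → r ℕ.< m → s ℕ.< m → + r ≡ + s mod + m → r ≡ s
    <∧≡-mod⇒≡ {r} {s} r<m s<m (mk≡mod m∣r-s) = ℤ.+-injective (ℤ.i-j≡0⇒i≡j _ _ (ℤ.∣i∣≡0⇒i≡0 ∣r-s∣≡0))
      where
      ∣r-s∣<m : ∣ + r - + s ∣ ℕ.< m
      ∣r-s∣<m = ℕ.≤-<-trans (subst (ℕ._≤ r ℕ.⊔ s) (cong ∣_∣ (sym (ℤ.m-n≡m⊖n r s))) (ℤ.∣m⊝n∣≤m⊔n r s))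
                            (ℕ.⊔-lub r<m s<m)
      ∣r-s∣≡0 : ∣ + r - + s ∣ ≡ 0
      ∣r-s∣≡0 = trans (sym (m<n⇒m%n≡m ∣r-s∣<m)) (ℕ.n∣m⇒m%n≡0 _ m (∣⇒∣ᵤ m∣r-s))

    %ℕ-cong : ∀ {u w} → u ≡ w mod + m → u %ℕ m ≡ w %ℕ m
    %ℕ-cong {u} {w} u≡w = <∧≡-mod⇒≡ (n%ℕd<d u m) (n%ℕd<d w m)
      (≡-mod-trans (%ℕ≡-mod u) (≡-mod-trans u≡w (≡-mod-sym (%ℕ≡-mod w))))

  2ⁿ : ℕ → ℤ
  2ⁿ n = + modulus n

  module _ (n : ℕ) where

    private instance
      2ⁿ≢0 : NonZero (modulus n)
      2ⁿ≢0 = modulus-nonZero n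

    toℕ-red : ∀ u → toℕ (red n u) ≡ u %ℕ modulus n
    toℕ-red u = trans (toℕ-fromℕ< _) (m<n⇒m%n≡m (n%ℕd<d u (modulus n)))

    red-rep : ∀ x → red n (rep n x) ≡ x
    red-rep x = toℕ-injective (trans (toℕ-red (rep n x)) (m<n⇒m%n≡m (toℕ<n x)))

    rep-red : ∀ u → rep n (red n u) ≡ u mod 2ⁿ n
    rep-red u = subst (_≡ u mod 2ⁿ n) (cong +_ (sym (toℕ-red u))) (%ℕ≡-mod (modulus n) u)

    red-cong : ∀ {u w} → u ≡ w mod 2ⁿ n → red n u ≡ red n w
    red-cong {u} {w} u≡w = toℕ-injective (trans (toℕ-red u) (trans (%ℕ-cong (modulus n) u≡w) (sym (toℕ-red w))))

open Congruence

module Action where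

  import Data.Nat as ℕ
  import Data.Nat.Properties as ℕ
  import Data.Nat.Divisibility as ℕ
  open import Data.Integer as ℤ using (ℤ; +_; _+_; _-_; _*_; -_)
  import Data.Integer.Properties as ℤ
  open import Data.Integer.Divisibility.Signed using (_∣_; ∣m⇒∣m*n; ∣⇒∣ᵤ)
  open import Data.Integer.Tactic.RingSolver using (solve-∀)
  open import Data.Fin as Fin using (Fin)
  open import Data.Vec.Functional using (Vector; []; _∷_)
  open import Relation.Nullary using (¬_)

  infixr 5 _*ᵥ_

  sum4-cong : ∀ {f g} → (∀ k → f k ≡ g k) → sum4 f ≡ sum4 g
  sum4-cong f≡g = cong₂ _+_ (cong₂ _+_ (cong₂ _+_ (f≡g f0) (f≡g f1)) (f≡g f2)) (f≡g f3)

  _*ᵥ_ : Mat → Vector ℤ 4 → Vector ℤ 4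
  (A *ᵥ v) i = sum4 (λ k → A i k * v k)

  *ᵥ-⊗ : ∀ A B v i → ((A ⊗ B) *ᵥ v) i ≡ (A *ᵥ B *ᵥ v) i
  *ᵥ-⊗ A B v i = identity
    (A i f0) (A i f1) (A i f2) (A i f3)
    (B f0 f0) (B f0 f1) (B f0 f2) (B f0 f3) (B f1 f0) (B f1 f1) (B f1 f2) (B f1 f3)
    (B f2 f0) (B f2 f1) (B f2 f2) (B f2 f3) (B f3 f0) (B f3 f1) (B f3 f2) (B f3 f3)
    (v f0) (v f1) (v f2) (v f3)
    where
    identity : ∀ a₀ a₁ a₂ a₃ b₀₀ b₀₁ b₀₂ b₀₃ b₁₀ b₁₁ b₁₂ b₁₃ b₂₀ b₂₁ b₂₂ b₂₃ b₃₀ b₃₁ b₃₂ b₃₃ v₀ v₁ v₂ v₃ →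
        (a₀ * b₀₀ + a₁ * b₁₀ + a₂ * b₂₀ + a₃ * b₃₀) * v₀ + (a₀ * b₀₁ + a₁ * b₁₁ + a₂ * b₂₁ + a₃ * b₃₁) * v₁
      + (a₀ * b₀₂ + a₁ * b₁₂ + a₂ * b₂₂ + a₃ * b₃₂) * v₂ + (a₀ * b₀₃ + a₁ * b₁₃ + a₂ * b₂₃ + a₃ * b₃₃) * v₃
      ≡   a₀ * (b₀₀ * v₀ + b₀₁ * v₁ + b₀₂ * v₂ + b₀₃ * v₃) + a₁ * (b₁₀ * v₀ + b₁₁ * v₁ + b₁₂ * v₂ + b₁₃ * v₃)
        + a₂ * (b₂₀ * v₀ + b₂₁ * v₁ + b₂₂ * v₂ + b₂₃ * v₃) + a₃ * (b₃₀ * v₀ + b₃₁ * v₁ + b₃₂ * v₂ + b₃₃ * v₃)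
    identity = solve-∀

  *ᵥ-diagM : ∀ d v i → (diagM d *ᵥ v) i ≡ d i * v i
  *ᵥ-diagM d v Fin.zero = identity₀ (d f0) (v f0) (v f1) (v f2) (v f3)
    where
    identity₀ : ∀ d v₀ v₁ v₂ v₃ → d * v₀ + + 0 * v₁ + + 0 * v₂ + + 0 * v₃ ≡ d * v₀
    identity₀ = solve-∀
  *ᵥ-diagM d v (Fin.suc Fin.zero) = identity₁ (d f1) (v f0) (v f1) (v f2) (v f3)
    where
    identity₁ : ∀ d v₀ v₁ v₂ v₃ → + 0 * v₀ + d * v₁ + + 0 * v₂ + + 0 * v₃ ≡ d * v₁
    identity₁ = solve-∀
  *ᵥ-diagM d v (Fin.suc (Fin.suc Fin.zero)) = identity₂ (d f2) (v f0) (v f1) (v f2) (v f3)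
    where
    identity₂ : ∀ d v₀ v₁ v₂ v₃ → + 0 * v₀ + + 0 * v₁ + d * v₂ + + 0 * v₃ ≡ d * v₂
    identity₂ = solve-∀
  *ᵥ-diagM d v (Fin.suc (Fin.suc (Fin.suc Fin.zero))) = identity₃ (d f3) (v f0) (v f1) (v f2) (v f3)
    where
    identity₃ : ∀ d v₀ v₁ v₂ v₃ → + 0 * v₀ + + 0 * v₁ + + 0 * v₂ + d * v₃ ≡ d * v₃
    identity₃ = solve-∀

  -- idM and diagM (λ _ → + 1) agree on each concrete pair of indices.
  *ᵥ-idM : ∀ v i → (idM *ᵥ v) i ≡ v i
  *ᵥ-idM v i = trans (as-diagM i) (ℤ.*-identityˡ (v i))
    where
    as-diagM : ∀ i → (idM *ᵥ v) i ≡ + 1 * v i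
    as-diagM Fin.zero = *ᵥ-diagM (λ _ → + 1) v f0
    as-diagM (Fin.suc Fin.zero) = *ᵥ-diagM (λ _ → + 1) v f1
    as-diagM (Fin.suc (Fin.suc Fin.zero)) = *ᵥ-diagM (λ _ → + 1) v f2
    as-diagM (Fin.suc (Fin.suc (Fin.suc Fin.zero))) = *ᵥ-diagM (λ _ → + 1) v f3

  *ᵥ-zeroʳ : ∀ A i → (A *ᵥ (λ _ → + 0)) i ≡ + 0
  *ᵥ-zeroʳ A i = identity (A i f0) (A i f1) (A i f2) (A i f3)
    where
    identity : ∀ a₀ a₁ a₂ a₃ → a₀ * + 0 + a₁ * + 0 + a₂ * + 0 + a₃ * + 0 ≡ + 0
    identity = solve-∀

  *ᵥ-≈M : ∀ {A B} → A ≈M B → ∀ v i → (A *ᵥ v) i ≡ (B *ᵥ v) i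
  *ᵥ-≈M A≈B v i = sum4-cong (λ k → cong (_* v k) (A≈B i k))

  *ᵥ-cong : ∀ {k} A {v w} → (∀ j → v j ≡ w j mod k) → ∀ i → (A *ᵥ v) i ≡ (A *ᵥ w) i mod k
  *ᵥ-cong {k} A {v} {w} v≡w i =
    ≡-mod-+ (≡-mod-+ (≡-mod-+ (entry f0) (entry f1)) (entry f2)) (entry f3)
    where
    entry : ∀ j → A i j * v j ≡ A i j * w j mod k
    entry j = ≡-mod-* (≡-mod-refl (A i j)) (v≡w j)

  -- oneH n and minusOneH n are reduce n (scalar 1ℤ) and reduce n (scalar -1ℤ) by definition.
  scalar : ℤ → Vector ℤ 4
  scalar s = s ∷ + 0 ∷ + 0 ∷ + 0 ∷ []

  *ᵥ-scalar : ∀ A s i → (A *ᵥ scalar s) i ≡ A i f0 * s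
  *ᵥ-scalar A s i = identity (A i f0) (A i f1) (A i f2) (A i f3) s
    where
    identity : ∀ a₀ a₁ a₂ a₃ s → a₀ * s + a₁ * + 0 + a₂ * + 0 + a₃ * + 0 ≡ a₀ * s
    identity = solve-∀

  module _ (n : ℕ) where

    lift : H n → Vector ℤ 4
    lift (x₁ , x₂ , x₃ , x₄) = rep n x₁ ∷ rep n x₂ ∷ rep n x₃ ∷ rep n x₄ ∷ []

    reduce : Vector ℤ 4 → H n
    reduce w = red n (w f0) , red n (w f1) , red n (w f2) , red n (w f3)

    lift-reduce : ∀ w i → lift (reduce w) i ≡ w i mod 2ⁿ n
    lift-reduce w Fin.zero = rep-red n (w f0)
    lift-reduce w (Fin.suc Fin.zero) = rep-red n (w f1)
    lift-reduce w (Fin.suc (Fin.suc Fin.zero)) = rep-red n (w f2)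
    lift-reduce w (Fin.suc (Fin.suc (Fin.suc Fin.zero))) = rep-red n (w f3)

    reduce-lift : ∀ z → reduce (lift z) ≡ z
    reduce-lift (x₁ , x₂ , x₃ , x₄) =
      cong₂ _,_ (red-rep n x₁) (cong₂ _,_ (red-rep n x₂) (cong₂ _,_ (red-rep n x₃) (red-rep n x₄)))

    reduce≡reduce⇔ : ∀ {v w} → reduce v ≡ reduce w ⇔ (∀ i → v i ≡ w i mod 2ⁿ n)
    reduce≡reduce⇔ {v} {w} = mk⇔ to from
      where
      to : reduce v ≡ reduce w → ∀ i → v i ≡ w i mod 2ⁿ n
      to eq i = ≡-mod-trans (≡-mod-sym (lift-reduce v i))
                  (subst (λ z → lift z i ≡ w i mod 2ⁿ n) (sym eq) (lift-reduce w i))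
      from : (∀ i → v i ≡ w i mod 2ⁿ n) → reduce v ≡ reduce w
      from v≡w = cong₂ _,_ (red-cong n (v≡w f0))
                   (cong₂ _,_ (red-cong n (v≡w f1)) (cong₂ _,_ (red-cong n (v≡w f2)) (red-cong n (v≡w f3))))

    reduce-cong : ∀ {v w} → (∀ i → v i ≡ w i) → reduce v ≡ reduce w
    reduce-cong v≡w = Equivalence.from reduce≡reduce⇔ (λ i → ≡⇒≡-mod (v≡w i))

    -- zeroH n is reduce (λ _ → + 0) by definition.
    reduce≡zeroH⇔ : ∀ {w} → reduce w ≡ zeroH n ⇔ (∀ i → 2ⁿ n ∣ w i)
    reduce≡zeroH⇔ {w} = mk⇔ (λ eq i → Equivalence.to ≡0-mod⇔∣ (Equivalence.to w≡0⇔ eq i))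
                            (λ 2ⁿ∣w → Equivalence.from w≡0⇔ (λ i → Equivalence.from ≡0-mod⇔∣ (2ⁿ∣w i)))
      where
      w≡0⇔ : reduce w ≡ reduce (λ _ → + 0) ⇔ (∀ i → w i ≡ + 0 mod 2ⁿ n)
      w≡0⇔ = reduce≡reduce⇔

    act : Mat → H n → H n
    act A z = reduce (A *ᵥ lift z)

    act-reduce : ∀ A w → act A (reduce w) ≡ reduce (A *ᵥ w)
    act-reduce A w = Equivalence.from reduce≡reduce⇔ (*ᵥ-cong A (lift-reduce w))

    act-⊗ : ∀ A B z → act (A ⊗ B) z ≡ act A (act B z)
    act-⊗ A B z = trans (reduce-cong (*ᵥ-⊗ A B (lift z))) (sym (act-reduce A (B *ᵥ lift z)))

    act-idM : ∀ z → act idM z ≡ z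
    act-idM z = trans (reduce-cong (*ᵥ-idM (lift z))) (reduce-lift z)

    act-≈M : ∀ {A B} → A ≈M B → ∀ z → act A z ≡ act B z
    act-≈M A≈B z = reduce-cong (*ᵥ-≈M A≈B (lift z))

    act-zeroH : ∀ A → act A (zeroH n) ≡ zeroH n
    act-zeroH A = trans (act-reduce A (λ _ → + 0)) (reduce-cong (*ᵥ-zeroʳ A))

    act-inverse : ∀ U U′ → (U ⊗ U′) ≈M idM → ∀ z → act U (act U′ z) ≡ z
    act-inverse U U′ U⊗U′≈I z = begin
      act U (act U′ z)   ≡⟨ act-⊗ U U′ z ⟨
      act (U ⊗ U′) z     ≡⟨ act-≈M U⊗U′≈I z ⟩
      act idM z          ≡⟨ act-idM z ⟩
      z                  ∎
      where open ≡-Reasoning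

    act≡zeroH⇔ : ∀ U → Invertible U → ∀ {z} → act U z ≡ zeroH n ⇔ z ≡ zeroH n
    act≡zeroH⇔ U (U′ , _ , U′⊗U≈I) {z} = mk⇔
      (λ Uz≡0 → trans (sym (act-inverse U′ U U′⊗U≈I z)) (trans (cong (act U′) Uz≡0) (act-zeroH U′)))
      (λ z≡0 → trans (cong (act U) z≡0) (act-zeroH U))

    act-diagM≡zeroH⇔ : ∀ d {z} → act (diagM d) z ≡ zeroH n ⇔ (∀ i → 2ⁿ n ∣ d i * lift z i)
    act-diagM≡zeroH⇔ d {z} = mk⇔
      (λ Dz≡0 i → subst (2ⁿ n ∣_) (*ᵥ-diagM d (lift z) i) (Equivalence.to Dz≡0⇔ Dz≡0 i))
      (λ 2ⁿ∣dz → Equivalence.from Dz≡0⇔ (λ i → subst (2ⁿ n ∣_) (sym (*ᵥ-diagM d (lift z) i)) (2ⁿ∣dz i)))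
      where
      Dz≡0⇔ : act (diagM d) z ≡ zeroH n ⇔ (∀ i → 2ⁿ n ∣ (diagM d *ᵥ lift z) i)
      Dz≡0⇔ = reduce≡zeroH⇔

    mulH≡act : ∀ a b → mulH n a b ≡ act (coeffMatrix n a) b
    mulH≡act (a₁ , a₂ , a₃ , a₄) (b₁ , b₂ , b₃ , b₄) =
      cong₂ _,_ (cong (red n) (identity₁ x₁ x₂ x₃ x₄ y₁ y₂ y₃ y₄))
        (cong₂ _,_ (cong (red n) (identity₂ x₁ x₂ x₃ x₄ y₁ y₂ y₃ y₄))
          (cong₂ _,_ (cong (red n) (identity₃ x₁ x₂ x₃ x₄ y₁ y₂ y₃ y₄))
                     (cong (red n) (identity₄ x₁ x₂ x₃ x₄ y₁ y₂ y₃ y₄))))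
      where
      x₁ x₂ x₃ x₄ y₁ y₂ y₃ y₄ : ℤ
      x₁ = rep n a₁ ; x₂ = rep n a₂ ; x₃ = rep n a₃ ; x₄ = rep n a₄
      y₁ = rep n b₁ ; y₂ = rep n b₂ ; y₃ = rep n b₃ ; y₄ = rep n b₄
      identity₁ : ∀ x₁ x₂ x₃ x₄ y₁ y₂ y₃ y₄ →
        x₁ * y₁ - x₂ * y₂ - x₃ * y₃ - x₄ * y₄ ≡ x₁ * y₁ + - x₂ * y₂ + - x₃ * y₃ + - x₄ * y₄
      identity₁ = solve-∀
      identity₂ : ∀ x₁ x₂ x₃ x₄ y₁ y₂ y₃ y₄ →
        x₂ * y₁ + x₁ * y₂ - x₄ * y₃ + x₃ * y₄ ≡ x₂ * y₁ + x₁ * y₂ + - x₄ * y₃ + x₃ * y₄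
      identity₂ = solve-∀
      identity₃ : ∀ x₁ x₂ x₃ x₄ y₁ y₂ y₃ y₄ →
        x₃ * y₁ + x₄ * y₂ + x₁ * y₃ - x₂ * y₄ ≡ x₃ * y₁ + x₄ * y₂ + x₁ * y₃ + - x₂ * y₄
      identity₃ = solve-∀
      identity₄ : ∀ x₁ x₂ x₃ x₄ y₁ y₂ y₃ y₄ →
        x₄ * y₁ - x₃ * y₂ + x₂ * y₃ + x₁ * y₄ ≡ x₄ * y₁ + - x₃ * y₂ + x₂ * y₃ + x₁ * y₄
      identity₄ = solve-∀

    mulH-zeroʳ : ∀ a → mulH n a (zeroH n) ≡ zeroH n
    mulH-zeroʳ a = trans (mulH≡act a (zeroH n)) (act-zeroH (coeffMatrix n a))

    coeffMatrix-col₀ : ∀ a i → coeffMatrix n a i f0 ≡ lift a i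
    coeffMatrix-col₀ (a₁ , a₂ , a₃ , a₄) Fin.zero = refl
    coeffMatrix-col₀ (a₁ , a₂ , a₃ , a₄) (Fin.suc Fin.zero) = refl
    coeffMatrix-col₀ (a₁ , a₂ , a₃ , a₄) (Fin.suc (Fin.suc Fin.zero)) = refl
    coeffMatrix-col₀ (a₁ , a₂ , a₃ , a₄) (Fin.suc (Fin.suc (Fin.suc Fin.zero))) = refl

    mulH-scalarʳ : ∀ a s → mulH n a (reduce (scalar s)) ≡ reduce (λ i → lift a i * s)
    mulH-scalarʳ a s = begin
      mulH n a (reduce (scalar s))               ≡⟨ mulH≡act a _ ⟩
      act (coeffMatrix n a) (reduce (scalar s))  ≡⟨ act-reduce (coeffMatrix n a) (scalar s) ⟩
      reduce (coeffMatrix n a *ᵥ scalar s)       ≡⟨ reduce-cong column₀ ⟩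
      reduce (λ i → lift a i * s)                ∎
      where
      open ≡-Reasoning
      column₀ : ∀ i → (coeffMatrix n a *ᵥ scalar s) i ≡ lift a i * s
      column₀ i = trans (*ᵥ-scalar (coeffMatrix n a) s i) (cong (_* s) (coeffMatrix-col₀ a i))

    mulH-unitʳ≡zeroH⇒≡zeroH : ∀ a s → s * s ≡ + 1 → mulH n a (reduce (scalar s)) ≡ zeroH n → a ≡ zeroH n
    mulH-unitʳ≡zeroH⇒≡zeroH a s s²≡1 as≡0 = begin
      a                ≡⟨ reduce-lift a ⟨
      reduce (lift a)  ≡⟨ Equivalence.from reduce≡zeroH⇔ 2ⁿ∣a ⟩
      zeroH n          ∎
      where
      open ≡-Reasoning
      2ⁿ∣as : ∀ i → 2ⁿ n ∣ lift a i * s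
      2ⁿ∣as = Equivalence.to reduce≡zeroH⇔ (trans (sym (mulH-scalarʳ a s)) as≡0)
      2ⁿ∣a : ∀ i → 2ⁿ n ∣ lift a i
      2ⁿ∣a i = subst (2ⁿ n ∣_) (trans (ℤ.*-assoc (lift a i) s s) (trans (cong (lift a i *_) s²≡1) (ℤ.*-identityʳ (lift a i))))
                 (∣m⇒∣m*n s (2ⁿ∣as i))

  minusOneH≡oneH : ∀ {n} → n ≡ 1 → minusOneH n ≡ oneH n
  minusOneH≡oneH refl = refl

  oneH≢minusOneH : ∀ {n} → 1 ℕ.< n → oneH n ≢ minusOneH n
  oneH≢minusOneH {n} 1<n 1≡-1 = 4≰2 (ℕ.≤-trans (ℕ.^-monoʳ-≤ 2 1<n) 2ⁿ≤2)
    where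
    2ⁿ∣2 : modulus n ℕ.∣ 2
    2ⁿ∣2 with mk≡mod 2ⁿ∣1+1 ← Equivalence.to (reduce≡reduce⇔ n {scalar (+ 1)} {scalar (- + 1)}) 1≡-1 f0 = ∣⇒∣ᵤ 2ⁿ∣1+1
    2ⁿ≤2 : modulus n ℕ.≤ 2
    2ⁿ≤2 = ℕ.∣⇒≤ 2ⁿ∣2
    4≰2 : ¬ (4 ℕ.≤ 2)
    4≰2 (ℕ.s≤s (ℕ.s≤s ()))

open Action

module Degree where

  open import Data.Nat as ℕ using (_+_; _*_; _^_; _<_)
  import Data.Nat.Properties as ℕ
  open import Data.Integer using (1ℤ; -1ℤ)
  open import Data.Empty using (⊥-elim)
  open import Data.Sum using (_⊎_; inj₁; inj₂)
  open import Data.List using ([]; _∷_; length; allFin; cartesianProduct)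
  open import Data.List.Properties using (length-tabulate)
  open import Data.List.Membership.Propositional using (_∈_)
  open import Data.List.Membership.Propositional.Properties using (∈-allFin; ∈-cartesianProduct⁺)
  open import Data.List.Relation.Unary.Any using (here; there)
  open import Data.List.Relation.Unary.All using ([]; _∷_)
  open import Data.List.Relation.Unary.AllPairs using ([]; _∷_)
  open import Data.List.Relation.Unary.Unique.Propositional using (Unique)
  import Data.List.Relation.Unary.Unique.Propositional.Properties as Unique
  open import Relation.Nullary using (¬_; yes; no)
  open import Relation.Nullary.Decidable using (_×-dec_; ¬?)
  open import Relation.Unary using (Decidable)
  open import Relation.Unary.Properties using (∁?; _∩?_)

  module _ (n : ℕ) where

    allH-unique : Unique (allH n)
    allH-unique = Unique.cartesianProduct⁺ (Unique.allFin⁺ _)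
      (Unique.cartesianProduct⁺ (Unique.allFin⁺ _) (Unique.cartesianProduct⁺ (Unique.allFin⁺ _) (Unique.allFin⁺ _)))

    ∈-allH : ∀ z → z ∈ allH n
    ∈-allH (z₁ , z₂ , z₃ , z₄) =
      ∈-cartesianProduct⁺ (∈-allFin z₁) (∈-cartesianProduct⁺ (∈-allFin z₂) (∈-cartesianProduct⁺ (∈-allFin z₃) (∈-allFin z₄)))

    length-allH : length (allH n) ≡ 2 ^ (4 * n)
    length-allH = begin
      length (allH n)    ≡⟨ length-cartesianProduct (allFin m) _ ⟩
      length (allFin m) * length (cartesianProduct (allFin m) (cartesianProduct (allFin m) (allFin m)))
        ≡⟨ cong₂ _*_ ℓ (trans (length-cartesianProduct (allFin m) _)
                         (cong₂ _*_ ℓ (trans (length-cartesianProduct (allFin m) (allFin m)) (cong₂ _*_ ℓ ℓ)))) ⟩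
      m * (m * (m * m))  ≡⟨ cong (λ k → m * (m * (m * k))) (sym (ℕ.*-identityʳ m)) ⟩
      m ^ 4              ≡⟨ ℕ.^-*-assoc 2 n 4 ⟩
      2 ^ (n * 4)        ≡⟨ cong (2 ^_) (ℕ.*-comm n 4) ⟩
      2 ^ (4 * n)        ∎
      where
      open ≡-Reasoning
      m : ℕ
      m = modulus n
      ℓ : length (allFin m) ≡ m
      ℓ = length-tabulate id

  Exceptional : ∀ n → H n → H n → Set
  Exceptional n a b = b ≡ oneH n ⊎ b ≡ minusOneH n ⊎ (b ≡ a × mulH n a a ≢ zeroH n)

  module _ {n : ℕ} {a : H n} (a-vertex : IsVertex n a) where

    private
      a≢0 : a ≢ zeroH n
      a≢0 = proj₁ a-vertex
      1≢a : oneH n ≢ a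
      1≢a 1≡a = proj₁ (proj₂ a-vertex) (sym 1≡a)
      -1≢a : minusOneH n ≢ a
      -1≢a -1≡a = proj₂ (proj₂ a-vertex) (sym -1≡a)

    nonAdjacent-nonAnnihilated⇔Exceptional : ∀ {b} →
      (mulH n a b ≢ zeroH n × ¬ (IsVertex n b × b ≢ a)) ⇔ Exceptional n a b
    nonAdjacent-nonAnnihilated⇔Exceptional {b} = mk⇔ to from
      where
      to : mulH n a b ≢ zeroH n × ¬ (IsVertex n b × b ≢ a) → Exceptional n a b
      to (ab≢0 , non-adjacent) with decH n b (oneH n) | decH n b (minusOneH n) | decH n b a | decH n b (zeroH n)
      ... | yes b≡1 | _ | _ | _ = inj₁ b≡1
      ... | no _ | yes b≡-1 | _ | _ = inj₂ (inj₁ b≡-1)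
      ... | no _ | no _ | yes refl | _ = inj₂ (inj₂ (refl , ab≢0))
      ... | no _ | no _ | no _ | yes refl = ⊥-elim (ab≢0 (mulH-zeroʳ n a))
      ... | no b≢1 | no b≢-1 | no b≢a | no b≢0 = ⊥-elim (non-adjacent ((b≢0 , b≢1 , b≢-1) , b≢a))
      from : Exceptional n a b → mulH n a b ≢ zeroH n × ¬ (IsVertex n b × b ≢ a)
      from (inj₁ refl) =
        (a≢0 ∘ mulH-unitʳ≡zeroH⇒≡zeroH n a 1ℤ refl) , λ (1-vertex , _) → proj₁ (proj₂ 1-vertex) refl
      from (inj₂ (inj₁ refl)) =
        (a≢0 ∘ mulH-unitʳ≡zeroH⇒≡zeroH n a -1ℤ refl) , λ (-1-vertex , _) → proj₂ (proj₂ -1-vertex) refl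
      from (inj₂ (inj₂ (refl , a²≢0))) = a²≢0 , λ (_ , a≢a) → a≢a refl

    deg+annCard+exceptional : ∀ {S} → Unique S → (∀ {b} → Exceptional n a b ⇔ b ∈ S) →
      deg n a + annCard n a + length S ≡ 2 ^ (4 * n)
    deg+annCard+exceptional {S} S! Exceptional⇔∈S = begin
      deg n a + annCard n a + length S
        ≡⟨ cong (_+ length S) (ℕ.+-comm (deg n a) (annCard n a)) ⟩
      annCard n a + deg n a + length S
        ≡⟨ ℕ.+-assoc (annCard n a) (deg n a) (length S) ⟩
      annCard n a + (deg n a + length S)
        ≡⟨ cong (annCard n a +_) (cong₂ _+_ deg≡ (sym |S|≡)) ⟩
      annCard n a + (count (∁? Z? ∩? R?) (allH n) + count (∁? Z? ∩? ∁? R?) (allH n))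
        ≡⟨ cong (annCard n a +_) (sym (count≡count∩+count∩∁ (∁? Z?) R? (allH n))) ⟩
      annCard n a + count (∁? Z?) (allH n)
        ≡⟨ count+count∁≡length Z? (allH n) ⟩
      length (allH n)
        ≡⟨ length-allH n ⟩
      2 ^ (4 * n) ∎
      where
      open ≡-Reasoning
      open Enumeration (allH-unique n) (∈-allH n)
      Z? : Decidable (λ b → mulH n a b ≡ zeroH n)
      Z? b = decH n (mulH n a b) (zeroH n)
      R? : Decidable (λ b → IsVertex n b × b ≢ a)
      R? b = isVertex? n b ×-dec ¬? (decH n b a)
      deg≡ : deg n a ≡ count (∁? Z? ∩? R?) (allH n)
      deg≡ = count-≐ _ (∁? Z? ∩? R?)
        ((λ (b-vertex , b≢a , ab≢0) → ab≢0 , b-vertex , b≢a) , (λ (ab≢0 , b-vertex , b≢a) → b-vertex , b≢a , ab≢0))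
        (allH n)
      |S|≡ : count (∁? Z? ∩? ∁? R?) (allH n) ≡ length S
      |S|≡ = count≡length-of (∁? Z? ∩? ∁? R?) S! (⇔.trans nonAdjacent-nonAnnihilated⇔Exceptional Exceptional⇔∈S)

    deg[n≡1,a²≡0] : n ≡ 1 → mulH n a a ≡ zeroH n → deg n a + annCard n a + 1 ≡ 2 ^ (4 * n)
    deg[n≡1,a²≡0] n≡1 a²≡0 = deg+annCard+exceptional ([] ∷ []) (mk⇔ to from)
      where
      to : ∀ {b} → Exceptional n a b → b ∈ oneH n ∷ []
      to (inj₁ b≡1) = here b≡1
      to (inj₂ (inj₁ b≡-1)) = here (trans b≡-1 (minusOneH≡oneH n≡1))
      to (inj₂ (inj₂ (_ , a²≢0))) = ⊥-elim (a²≢0 a²≡0)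
      from : ∀ {b} → b ∈ oneH n ∷ [] → Exceptional n a b
      from (here b≡1) = inj₁ b≡1

    deg[n≡1,a²≢0] : n ≡ 1 → mulH n a a ≢ zeroH n → deg n a + annCard n a + 2 ≡ 2 ^ (4 * n)
    deg[n≡1,a²≢0] n≡1 a²≢0 = deg+annCard+exceptional ((1≢a ∷ []) ∷ [] ∷ []) (mk⇔ to from)
      where
      to : ∀ {b} → Exceptional n a b → b ∈ oneH n ∷ a ∷ []
      to (inj₁ b≡1) = here b≡1
      to (inj₂ (inj₁ b≡-1)) = here (trans b≡-1 (minusOneH≡oneH n≡1))
      to (inj₂ (inj₂ (b≡a , _))) = there (here b≡a)
      from : ∀ {b} → b ∈ oneH n ∷ a ∷ [] → Exceptional n a b
      from (here b≡1) = inj₁ b≡1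
      from (there (here b≡a)) = inj₂ (inj₂ (b≡a , a²≢0))

    deg[1<n,a²≡0] : 1 < n → mulH n a a ≡ zeroH n → deg n a + annCard n a + 2 ≡ 2 ^ (4 * n)
    deg[1<n,a²≡0] 1<n a²≡0 = deg+annCard+exceptional ((oneH≢minusOneH 1<n ∷ []) ∷ [] ∷ []) (mk⇔ to from)
      where
      to : ∀ {b} → Exceptional n a b → b ∈ oneH n ∷ minusOneH n ∷ []
      to (inj₁ b≡1) = here b≡1
      to (inj₂ (inj₁ b≡-1)) = there (here b≡-1)
      to (inj₂ (inj₂ (_ , a²≢0))) = ⊥-elim (a²≢0 a²≡0)
      from : ∀ {b} → b ∈ oneH n ∷ minusOneH n ∷ [] → Exceptional n a b
      from (here b≡1) = inj₁ b≡1
      from (there (here b≡-1)) = inj₂ (inj₁ b≡-1)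

    deg[1<n,a²≢0] : 1 < n → mulH n a a ≢ zeroH n → deg n a + annCard n a + 3 ≡ 2 ^ (4 * n)
    deg[1<n,a²≢0] 1<n a²≢0 =
      deg+annCard+exceptional ((oneH≢minusOneH 1<n ∷ 1≢a ∷ []) ∷ (-1≢a ∷ []) ∷ [] ∷ []) (mk⇔ to from)
      where
      to : ∀ {b} → Exceptional n a b → b ∈ oneH n ∷ minusOneH n ∷ a ∷ []
      to (inj₁ b≡1) = here b≡1
      to (inj₂ (inj₁ b≡-1)) = there (here b≡-1)
      to (inj₂ (inj₂ (b≡a , _))) = there (there (here b≡a))
      from : ∀ {b} → b ∈ oneH n ∷ minusOneH n ∷ a ∷ [] → Exceptional n a b
      from (here b≡1) = inj₁ b≡1
      from (there (here b≡-1)) = inj₂ (inj₁ b≡-1)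
      from (there (there (here b≡a))) = inj₂ (inj₂ (b≡a , a²≢0))

open Degree

module Annihilator where

  open import Data.Nat as ℕ using (_*_; NonZero)
  open import Data.Nat.Divisibility using (_∣_; _∣?_)
  open import Data.Nat.GCD using (gcd)
  open import Data.Integer as ℤ using (ℤ; +_; ∣_∣)
  import Data.Integer.Properties as ℤ
  open import Data.Integer.Divisibility.Signed using (∣⇒∣ᵤ; ∣ᵤ⇒∣) renaming (_∣_ to _∣ᶻ_; _∣?_ to _∣ᶻ?_)
  open import Data.Fin as Fin using (Fin; toℕ)
  open import Data.List using (map; allFin; upTo; cartesianProduct)
  open import Relation.Nullary.Decidable using (_×-dec_)
  open import Relation.Unary using (Decidable)

  module _ (n : ℕ) where

    private
      m : ℕ
      m = modulus n
      instance
        2ⁿ≢0 : NonZero m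
        2ⁿ≢0 = modulus-nonZero n

    count-∣-*rep≡gcd : ∀ c → count (λ t → 2ⁿ n ∣ᶻ? c ℤ.* rep n t) (allFin m) ≡ gcd ∣ c ∣ m
    count-∣-*rep≡gcd c = begin
        count (λ t → 2ⁿ n ∣ᶻ? c ℤ.* rep n t) (allFin m)
      ≡⟨ count-≐ _ (λ t → m ∣? ∣ c ∣ * toℕ t) (to , from) (allFin m) ⟩
        count (λ t → m ∣? ∣ c ∣ * toℕ t) (allFin m)
      ≡⟨ count-map (λ t → m ∣? ∣ c ∣ * t) toℕ (allFin m) ⟨
        count (λ t → m ∣? ∣ c ∣ * t) (map toℕ (allFin m))
      ≡⟨ cong (count (λ t → m ∣? ∣ c ∣ * t)) (map-toℕ-allFin m) ⟩
        count (λ t → m ∣? ∣ c ∣ * t) (upTo m)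
      ≡⟨ count-∣-*≡gcd ∣ c ∣ m ⟩
        gcd ∣ c ∣ m ∎
      where
      open ≡-Reasoning
      to : ∀ {t} → 2ⁿ n ∣ᶻ c ℤ.* rep n t → m ∣ ∣ c ∣ * toℕ t
      to {t} 2ⁿ∣ct = subst (m ∣_) (ℤ.abs-* c (rep n t)) (∣⇒∣ᵤ 2ⁿ∣ct)
      from : ∀ {t} → m ∣ ∣ c ∣ * toℕ t → 2ⁿ n ∣ᶻ c ℤ.* rep n t
      from {t} m∣ct = ∣ᵤ⇒∣ (subst (m ∣_) (sym (ℤ.abs-* c (rep n t))) m∣ct)

    module _ (a : H n) (d : Fin 4 → ℤ) (U V : Mat) (U-inv : Invertible U) (V-inv : Invertible V)
             (U𝒜V≈D : ((U ⊗ coeffMatrix n a) ⊗ V) ≈M diagM d) where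

      private
        𝒜 : Mat
        𝒜 = coeffMatrix n a

        g : Fin 4 → ℕ
        g i = gcd ∣ d i ∣ m

        Q : Fin 4 → Zmod n → Set
        Q i t = 2ⁿ n ∣ᶻ d i ℤ.* rep n t

        Q? : ∀ i → Decidable (Q i)
        Q? i t = 2ⁿ n ∣ᶻ? d i ℤ.* rep n t

        Diag : H n → Set
        Diag (z₁ , z₂ , z₃ , z₄) = Q f0 z₁ × Q f1 z₂ × Q f2 z₃ × Q f3 z₄

        Diag? : Decidable Diag
        Diag? (z₁ , z₂ , z₃ , z₄) = Q? f0 z₁ ×-dec Q? f1 z₂ ×-dec Q? f2 z₃ ×-dec Q? f3 z₄

        Diag⇔ : ∀ {z} → Diag z ⇔ (∀ i → 2ⁿ n ∣ᶻ d i ℤ.* lift n z i)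
        Diag⇔ {z₁ , z₂ , z₃ , z₄} = mk⇔
          (λ (q₀ , q₁ , q₂ , q₃) → λ { Fin.zero → q₀ ; (Fin.suc Fin.zero) → q₁ ; (Fin.suc (Fin.suc Fin.zero)) → q₂
                                     ; (Fin.suc (Fin.suc (Fin.suc Fin.zero))) → q₃ })
          (λ q → q f0 , q f1 , q f2 , q f3)

      act-diagM≡act-mulH-act : ∀ z → act n (diagM d) z ≡ act n U (mulH n a (act n V z))
      act-diagM≡act-mulH-act z = begin
        act n (diagM d) z                  ≡⟨ act-≈M n U𝒜V≈D z ⟨
        act n ((U ⊗ 𝒜) ⊗ V) z              ≡⟨ act-⊗ n (U ⊗ 𝒜) V z ⟩
        act n (U ⊗ 𝒜) (act n V z)          ≡⟨ act-⊗ n U 𝒜 (act n V z) ⟩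
        act n U (act n 𝒜 (act n V z))      ≡⟨ cong (act n U) (mulH≡act n a (act n V z)) ⟨
        act n U (mulH n a (act n V z))     ∎
        where open ≡-Reasoning

      mulH-act≡zeroH⇔ : ∀ {z} → mulH n a (act n V z) ≡ zeroH n ⇔ act n (diagM d) z ≡ zeroH n
      mulH-act≡zeroH⇔ {z} = ⇔.trans (⇔.sym (act≡zeroH⇔ n U U-inv))
        (mk⇔ (trans (act-diagM≡act-mulH-act z)) (trans (sym (act-diagM≡act-mulH-act z))))

      annCard≡∏gcd : annCard n a ≡ g f0 * (g f1 * (g f2 * g f3))
      annCard≡∏gcd = begin
          count Z? (allH n)
        ≡⟨ count-∘-inverse Z? (act n V) (act n V′) (act-inverse n V′ V V′⊗V≈I) (act-inverse n V V′ V⊗V′≈I) ⟩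
          count (Z? ∘ act n V) (allH n)
        ≡⟨ count-≐ _ Diag? (Equivalence.from Diag⇔mulH-act≡zeroH , Equivalence.to Diag⇔mulH-act≡zeroH) (allH n) ⟩
          count Diag? (allH n)
        ≡⟨ count-cartesianProduct (Q? f0) _ (allFin m) _ ⟩
          count (Q? f0) (allFin m) * count _ (cartesianProduct (allFin m) (cartesianProduct (allFin m) (allFin m)))
        ≡⟨ cong (count (Q? f0) (allFin m) *_) (trans (count-cartesianProduct (Q? f1) _ (allFin m) _)
             (cong (count (Q? f1) (allFin m) *_) (count-cartesianProduct (Q? f2) (Q? f3) (allFin m) (allFin m)))) ⟩
          count (Q? f0) (allFin m) * (count (Q? f1) (allFin m) * (count (Q? f2) (allFin m) * count (Q? f3) (allFin m)))
        ≡⟨ cong₂ _*_ (count-Q f0) (cong₂ _*_ (count-Q f1) (cong₂ _*_ (count-Q f2) (count-Q f3))) ⟩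
          g f0 * (g f1 * (g f2 * g f3)) ∎
        where
        open ≡-Reasoning
        open Enumeration (allH-unique n) (∈-allH n)
        V′ : Mat
        V′ = proj₁ V-inv
        V⊗V′≈I : (V ⊗ V′) ≈M idM
        V⊗V′≈I = proj₁ (proj₂ V-inv)
        V′⊗V≈I : (V′ ⊗ V) ≈M idM
        V′⊗V≈I = proj₂ (proj₂ V-inv)
        Z? : Decidable (λ b → mulH n a b ≡ zeroH n)
        Z? b = decH n (mulH n a b) (zeroH n)
        Diag⇔mulH-act≡zeroH : ∀ {z} → Diag z ⇔ (mulH n a (act n V z) ≡ zeroH n)
        Diag⇔mulH-act≡zeroH = ⇔.trans Diag⇔ (⇔.trans (⇔.sym (act-diagM≡zeroH⇔ n d)) (⇔.sym mulH-act≡zeroH⇔))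
        count-Q : ∀ i → count (Q? i) (allFin m) ≡ g i
        count-Q i = count-∣-*rep≡gcd (d i)

  annCard≡gcdProduct : ∀ n a d → IsSmithNormalFormOf d (coeffMatrix n a) → + annCard n a ≡ gcdProduct n d
  annCard≡gcdProduct n a d (_ , _ , _ , U , V , U-inv , V-inv , U𝒜V≈D) = begin
    + annCard n a                     ≡⟨ cong +_ (annCard≡∏gcd n a d U V U-inv V-inv U𝒜V≈D) ⟩
    + (g₀ * (g₁ * (g₂ * g₃)))         ≡⟨ ℤ.pos-* g₀ _ ⟩
    + g₀ ℤ.* + (g₁ * (g₂ * g₃))       ≡⟨ cong (+ g₀ ℤ.*_) (trans (ℤ.pos-* g₁ _) (cong (+ g₁ ℤ.*_) (ℤ.pos-* g₂ g₃))) ⟩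
    + g₀ ℤ.* (+ g₁ ℤ.* (+ g₂ ℤ.* + g₃)) ≡⟨ ℤ.*-assoc (+ g₀) (+ g₁) _ ⟨
    + g₀ ℤ.* + g₁ ℤ.* (+ g₂ ℤ.* + g₃)   ≡⟨ ℤ.*-assoc (+ g₀ ℤ.* + g₁) (+ g₂) (+ g₃) ⟨
    gcdProduct n d                    ∎
    where
    open ≡-Reasoning
    g₀ g₁ g₂ g₃ : ℕ
    g₀ = gcd ∣ d f0 ∣ (modulus n)
    g₁ = gcd ∣ d f1 ∣ (modulus n)
    g₂ = gcd ∣ d f2 ∣ (modulus n)
    g₃ = gcd ∣ d f3 ∣ (modulus n)

open Annihilator

open import Data.Nat using (_+_; _*_; _^_; _≤_; _<_)
open import Data.Integer using (ℤ; +_)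
open import Data.Fin using (Fin)

theorem4p5 : (n : ℕ) → 1 ≤ n → (a : H n) → IsVertex n a →
    ((n ≡ 1 →
        (mulH n a a ≡ zeroH n → deg n a + annCard n a + 1 ≡ 2 ^ (4 * n))
      × (mulH n a a ≢ zeroH n → deg n a + annCard n a + 2 ≡ 2 ^ (4 * n)))
    × (1 < n →
        (mulH n a a ≡ zeroH n → deg n a + annCard n a + 2 ≡ 2 ^ (4 * n))
      × (mulH n a a ≢ zeroH n → deg n a + annCard n a + 3 ≡ 2 ^ (4 * n))))
    × ((d : Fin 4 → ℤ) → IsSmithNormalFormOf d (coeffMatrix n a) →
        + annCard n a ≡ gcdProduct n d)
theorem4p5 n _ a a-vertex =
    ( (λ n≡1 → deg[n≡1,a²≡0] a-vertex n≡1 , deg[n≡1,a²≢0] a-vertex n≡1)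
    , (λ 1<n → deg[1<n,a²≡0] a-vertex 1<n , deg[1<n,a²≢0] a-vertex 1<n) )
  , annCard≡gcdProduct n a
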